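{- Let $\mathcal{G}_{12,\mathrm{bip}}$ be the set of all permutations $\pi$ such that the occurrence graph $G_{12}(\pi)$ is bipartite. Then \[ \mathcal{G}_{12,\mathrm{bip}} = \mathrm{Av}(123, 1432, 3214). \]
   Context: Permutations of all lengths $n\ge0$ are considered. For a permutation $\pi$ of length $n$, $V_{12}(\pi)$ is the set of pairs $\{i,j\}$ with $1\le i<j\le n$ and $\pi(i)<\pi(j)$, and the occurrence graph $G_{12}(\pi)$ is the simple undirected graph with vertex set $V_{12}(\pi)$ in which two vertices are adjacent iff they share exactly one element. A graph is bipartite if its vertices can be colored with two colors so that no edge joins two vertices of the same color. A permutation $\pi$ of length $n$ contains a permutation $q$ of length $k$ if there are indices $i_1<\dots<i_k$ with $\pi(i_1)\cdots\pi(i_k)$ order-isomorphic to $q$, and avoids $q$ otherwise; $\mathrm{Av}(M)$ is the set of permutations avoiding every element of $M$. -}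

module Defs where

open import Data.Nat using (ℕ)
import Data.Nat as ℕ
open import Data.Fin using (Fin; _<_)
open import Data.Fin.Permutation using (Permutation′; _⟨$⟩ʳ_)
open import Data.Vec using (Vec; lookup; []; _∷_)
open import Data.Bool using (Bool)
open import Data.Product using (Σ; _×_; _,_; proj₁; proj₂)
open import Data.Sum using (_⊎_)
open import Relation.Binary.PropositionalEquality using (_≡_; _≢_)
open import Relation.Nullary using (¬_)

record Graph : Set₁ where
  field
    Vertex : Set
    Adj    : Vertex → Vertex → Set
open Graph public

Bipartite : Graph → Set
Bipartite G = Σ (Vertex G → Bool) λ c → ∀ u v → Adj G u v → c u ≢ c v

V12 : ∀ {n} → Permutation′ n → Set
V12 {n} π = Σ (Fin n × Fin n) λ p →
  (proj₁ p < proj₂ p) × ((π ⟨$⟩ʳ proj₁ p) < (π ⟨$⟩ʳ proj₂ p))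

SharesExactlyOne : ∀ {n} → (Fin n × Fin n) → (Fin n × Fin n) → Set
SharesExactlyOne (i , j) (k , l) =
    (i ≡ k × j ≢ l) ⊎ (i ≡ l × j ≢ k) ⊎ (j ≡ k × i ≢ l) ⊎ (j ≡ l × i ≢ k)

G12 : ∀ {n} → Permutation′ n → Graph
G12 π = record
  { Vertex = V12 π
  ; Adj    = λ u v → SharesExactlyOne (proj₁ u) (proj₁ v)
  }

Contains : ∀ {n k} → Permutation′ n → Vec ℕ k → Set
Contains {n} {k} π q = Σ (Fin k → Fin n) λ f →
    (∀ a b → a < b → f a < f b) ×
    (∀ a b → ((π ⟨$⟩ʳ f a) < (π ⟨$⟩ʳ f b) → lookup q a ℕ.< lookup q b)
           × (lookup q a ℕ.< lookup q b → (π ⟨$⟩ʳ f a) < (π ⟨$⟩ʳ f b)))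

Avoids : ∀ {n k} → Permutation′ n → Vec ℕ k → Set
Avoids π q = ¬ Contains π q

p123 : Vec ℕ 3
p123 = 1 ∷ 2 ∷ 3 ∷ []

p1432 : Vec ℕ 4
p1432 = 1 ∷ 4 ∷ 3 ∷ 2 ∷ []

p3214 : Vec ℕ 4
p3214 = 3 ∷ 2 ∷ 1 ∷ 4 ∷ []

InAv123-1432-3214 : ∀ {n} → Permutation′ n → Set
InAv123-1432-3214 π = Avoids π p123 × Avoids π p1432 × Avoids π p3214

module Submission where

-- An occurrence of 123, 1432 or 3214 yields three pairwise adjacent vertices
-- of G₁₂(π) — pairs {1,2},{1,3},{2,3}, resp. three pairs with a common
-- first or last index — hence an odd cycle.  Conversely, if π avoids 123 then
-- every vertex (i , j) has i a left-to-right minimum and j a right-to-left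
-- maximum, and no two vertices are adjacent through a shared index used once
-- as smaller and once as larger element.  Colour (i , j) by the parity of the
-- number of left-to-right minima before i plus the number of right-to-left
-- maxima before j.  Two vertices (i , j) , (i , j') with j < j' are separated
-- by no right-to-left maximum strictly between j and j' (it would complete a
-- 1432), so exactly one summand changes by one; symmetrically for a shared
-- j, where an intermediate left-to-right minimum would complete a 3214.

open import Defs
open import Data.Nat using (ℕ)
open import Data.Fin.Permutation using (Permutation′)
open import Function.Bundles using (_⇔_)

import Data.Nat as ℕ
import Data.Nat.Properties as ℕ
open import Data.Bool using (Bool; false; not; _xor_)
open import Data.Bool.Properties using (¬-not; not-¬; not-injective; not-distribʳ-xor; not-distribˡ-xor)
open import Data.Empty using (⊥; ⊥-elim)
open import Data.Fin using (Fin; zero; suc; toℕ; inject₁; #_; _<_; _<?_; _≟_)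
open import Data.Fin.Properties using (any?; all?; toℕ-injective; <-cmp; <⇒≢; <-trans; <-asym; <-irrefl)
open import Data.Fin.Permutation using (_⟨$⟩ʳ_; _⟨$⟩ˡ_; inverseˡ)
open import Data.Product using (_×_; _,_; proj₁; proj₂)
open import Data.Sum using (inj₁; inj₂)
open import Data.Vec using (Vec; lookup; []; _∷_)
open import Function.Bundles using (mk⇔)
open import Relation.Binary using (Rel; Transitive; tri<; tri≈; tri>)
open import Relation.Binary.PropositionalEquality using (_≡_; _≢_; refl; sym; trans; cong; subst₂; ≢-sym; module ≡-Reasoning)
open import Relation.Nullary using (¬_; yes; no)
open import Relation.Nullary.Decidable using (True; toWitness; _×-dec_; _→-dec_)
open import Relation.Unary using (Pred; Decidable)
open import Level using (0ℓ)

<-by-computation : ∀ {m k : ℕ} {_ : True (m ℕ.<? k)} → m ℕ.< k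
<-by-computation {m} {k} {m<k} = toWitness m<k

triangle-not-bipartite : ∀ (G : Graph) {u v w} →
  Bipartite G → Adj G u v → Adj G u w → Adj G v w → ⊥
triangle-not-bipartite G (c , proper) uv uw vw =
  proper _ _ vw (not-injective (trans (sym (¬-not (proper _ _ uv))) (¬-not (proper _ _ uw))))

module _ {a ℓ} {A : Set a} {_≺_ : Rel A ℓ} (≺-trans : Transitive _≺_) where

  increasing-by-steps : ∀ {k} (g : Fin (ℕ.suc k) → A) →
    (∀ t → g (inject₁ t) ≺ g (suc t)) → ∀ {s t} → s < t → g s ≺ g t
  increasing-by-steps g step {zero} {suc zero} _ = step zero
  increasing-by-steps {ℕ.suc k} g step {zero} {suc (suc t)} _ =
    ≺-trans (step zero) (increasing-by-steps (λ x → g (suc x)) (λ x → step (suc x)) {zero} {suc t} ℕ.z<s)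
  increasing-by-steps {ℕ.suc k} g step {suc s} {suc t} (ℕ.s<s s<t) =
    increasing-by-steps (λ x → g (suc x)) (λ x → step (suc x)) s<t

-- rank a is the entry q[a] minus one and byRank its inverse, so a word with
-- a ranking is order-isomorphic to a permutation of 1 … k.
record Ranking {k} (q : Vec ℕ k) : Set where
  field
    rank          : Fin k → Fin k
    byRank        : Fin k → Fin k
    lookup≡1+rank : ∀ a → lookup q a ≡ ℕ.suc (toℕ (rank a))
    byRank∘rank   : ∀ a → byRank (rank a) ≡ a

  rank-monotone : ∀ {a b} → lookup q a ℕ.< lookup q b → rank a < rank b
  rank-monotone {a} {b} qa<qb = ℕ.s<s⁻¹ (subst₂ ℕ._<_ (lookup≡1+rank a) (lookup≡1+rank b) qa<qb)

  lookup-injective : ∀ {a b} → lookup q a ≡ lookup q b → a ≡ b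
  lookup-injective {a} {b} qa≡qb = begin
    a                ≡⟨ sym (byRank∘rank a) ⟩
    byRank (rank a)  ≡⟨ cong byRank (toℕ-injective (ℕ.suc-injective rank-eq)) ⟩
    byRank (rank b)  ≡⟨ byRank∘rank b ⟩
    b                ∎
    where
    open ≡-Reasoning
    rank-eq : ℕ.suc (toℕ (rank a)) ≡ ℕ.suc (toℕ (rank b))
    rank-eq = trans (sym (lookup≡1+rank a)) (trans qa≡qb (lookup≡1+rank b))

open Ranking

involutive-ranking : ∀ {k} (q : Vec ℕ k) (r : Vec (Fin k) k) →
  {True (all? λ a → lookup q a ℕ.≟ ℕ.suc (toℕ (lookup r a)))} →
  {True (all? λ a → lookup r (lookup r a) ≟ a)} → Ranking q
involutive-ranking q r {lookup≡} {involutive} = record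
  { rank = lookup r ; byRank = lookup r
  ; lookup≡1+rank = toWitness lookup≡ ; byRank∘rank = toWitness involutive }

ranking-123 : Ranking p123
ranking-123 = involutive-ranking p123 (# 0 ∷ # 1 ∷ # 2 ∷ [])

ranking-1432 : Ranking p1432
ranking-1432 = involutive-ranking p1432 (# 0 ∷ # 3 ∷ # 2 ∷ # 1 ∷ [])

ranking-3214 : Ranking p3214
ranking-3214 = involutive-ranking p3214 (# 2 ∷ # 1 ∷ # 0 ∷ # 3 ∷ [])

module _ {p} {P : Pred ℕ p} (P? : Decidable P) where

  parityBelow : ℕ → Bool
  parityBelow ℕ.zero = false
  parityBelow (ℕ.suc k) with P? k
  ... | yes _ = not (parityBelow k)
  ... | no _  = parityBelow k

  parityBelow-flip : ∀ {x y} → x ℕ.< y → P x → (∀ {z} → x ℕ.< z → z ℕ.< y → ¬ P z) →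
    parityBelow y ≡ not (parityBelow x)
  parityBelow-flip {x} {ℕ.suc y} x<1+y Px none with ℕ.m<1+n⇒m<n∨m≡n x<1+y
  ... | inj₂ refl with P? x
  ...   | yes _  = refl
  ...   | no ¬Px = ⊥-elim (¬Px Px)
  parityBelow-flip {x} {ℕ.suc y} x<1+y Px none | inj₁ x<y with P? y
  ...   | yes Py = ⊥-elim (none x<y (ℕ.n<1+n y) Py)
  ...   | no _   = parityBelow-flip x<y Px (λ x<z z<y → none x<z (ℕ.m<n⇒m<1+n z<y))

module _ {n p} {Q : Pred (Fin n) p} (Q? : Decidable Q) where

  parityBefore : Fin n → Bool
  parityBefore i = parityBelow (λ k → any? λ x → (toℕ x ℕ.≟ k) ×-dec Q? x) (toℕ i)

  parityBefore-flip : ∀ {x y} → x < y → Q x → (∀ {z} → x < z → z < y → ¬ Q z) →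
    parityBefore y ≡ not (parityBefore x)
  parityBefore-flip {x} x<y Qx none =
    parityBelow-flip _ x<y (x , refl , Qx) λ { x<z z<y (z , refl , Qz) → none x<z z<y Qz }

module _ {n : ℕ} (π : Permutation′ n) where

  private
    π[_] : Fin n → Fin n
    π[ x ] = π ⟨$⟩ʳ x

  π-injective : ∀ {x y} → π[ x ] ≡ π[ y ] → x ≡ y
  π-injective {x} {y} πx≡πy =
    trans (sym (inverseˡ π)) (trans (cong (π ⟨$⟩ˡ_) πx≡πy) (inverseˡ π))

  Ascent : Fin n → Fin n → Set
  Ascent i j = i < j × π[ i ] < π[ j ]

  -- An occurrence is given by its positions, listed left to right, and by
  -- the chain of its values, listed in increasing order.
  contains-by-chains : ∀ {k} {q : Vec ℕ (ℕ.suc k)} (R : Ranking q) (f : Fin (ℕ.suc k) → Fin n) →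
    (∀ t → f (inject₁ t) < f (suc t)) →
    (∀ t → π[ f (byRank R (inject₁ t)) ] < π[ f (byRank R (suc t)) ]) →
    Contains π q
  contains-by-chains {q = q} R f f-step π-step =
    f , (λ a b → increasing-by-steps {_≺_ = _<_} <-trans f f-step) , λ a b → reflect a b , preserve a b
    where
    preserve : ∀ a b → lookup q a ℕ.< lookup q b → π[ f a ] < π[ f b ]
    preserve a b qa<qb =
      subst₂ (λ x y → π[ f x ] < π[ f y ]) (byRank∘rank R a) (byRank∘rank R b)
        (increasing-by-steps {_≺_ = _<_} <-trans (λ t → π[ f (byRank R t) ]) π-step (rank-monotone R qa<qb))
    reflect : ∀ a b → π[ f a ] < π[ f b ] → lookup q a ℕ.< lookup q b
    reflect a b πfa<πfb with ℕ.<-cmp (lookup q a) (lookup q b)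
    ... | tri< qa<qb _ _ = qa<qb
    ... | tri≈ _ qa≡qb _ = ⊥-elim (<-irrefl (cong (λ x → π[ f x ]) (lookup-injective R qa≡qb)) πfa<πfb)
    ... | tri> _ _ qa>qb = ⊥-elim (<-asym πfa<πfb (preserve b a qa>qb))

  contains-123 : ∀ {a b c} → Ascent a b → Ascent b c → Contains π p123
  contains-123 {a} {b} {c} (a<b , πa<πb) (b<c , πb<πc) =
    contains-by-chains ranking-123 (lookup (a ∷ b ∷ c ∷ []))
      (λ { zero → a<b ; (suc zero) → b<c })
      (λ { zero → πa<πb ; (suc zero) → πb<πc })

  contains-1432 : ∀ {a b c d} → a < b → b < c → c < d →
    π[ a ] < π[ d ] → π[ d ] < π[ c ] → π[ c ] < π[ b ] → Contains π p1432
  contains-1432 {a} {b} {c} {d} a<b b<c c<d πa<πd πd<πc πc<πb =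
    contains-by-chains ranking-1432 (lookup (a ∷ b ∷ c ∷ d ∷ []))
      (λ { zero → a<b ; (suc zero) → b<c ; (suc (suc zero)) → c<d })
      (λ { zero → πa<πd ; (suc zero) → πd<πc ; (suc (suc zero)) → πc<πb })

  contains-3214 : ∀ {a b c d} → a < b → b < c → c < d →
    π[ c ] < π[ b ] → π[ b ] < π[ a ] → π[ a ] < π[ d ] → Contains π p3214
  contains-3214 {a} {b} {c} {d} a<b b<c c<d πc<πb πb<πa πa<πd =
    contains-by-chains ranking-3214 (lookup (a ∷ b ∷ c ∷ d ∷ []))
      (λ { zero → a<b ; (suc zero) → b<c ; (suc (suc zero)) → c<d })
      (λ { zero → πc<πb ; (suc zero) → πb<πa ; (suc (suc zero)) → πa<πd })

  occurrence-vertex : ∀ {k} (q : Vec ℕ k) → Contains π q → (a b : Fin k) →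
    {True (a <? b)} → {True (lookup q a ℕ.<? lookup q b)} → V12 π
  occurrence-vertex q (f , f-increasing , order-iso) a b {a<b} {qa<qb} =
    (f a , f b) , f-increasing a b (toWitness a<b) , proj₂ (order-iso a b) (toWitness qa<qb)

  bipartite⇒avoids : Bipartite (G12 π) → InAv123-1432-3214 π
  bipartite⇒avoids bip = avoids-123 , avoids-1432 , avoids-3214
    where
    no-triangle : ∀ u v w → Adj (G12 π) u v → Adj (G12 π) u w → Adj (G12 π) v w → ⊥
    no-triangle u v w = triangle-not-bipartite (G12 π) {u} {v} {w} bip

    avoids-123 : Avoids π p123
    avoids-123 occ@(f , f-increasing , _) =
      no-triangle
        (occurrence-vertex p123 occ (# 0) (# 1))
        (occurrence-vertex p123 occ (# 0) (# 2))
        (occurrence-vertex p123 occ (# 1) (# 2))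
        (inj₁ (refl , <⇒≢ (f-increasing (# 1) (# 2) <-by-computation)))
        (inj₂ (inj₂ (inj₁ (refl , <⇒≢ (f-increasing (# 0) (# 2) <-by-computation)))))
        (inj₂ (inj₂ (inj₂ (refl , <⇒≢ (f-increasing (# 0) (# 1) <-by-computation)))))

    avoids-1432 : Avoids π p1432
    avoids-1432 occ@(f , f-increasing , _) =
      no-triangle
        (occurrence-vertex p1432 occ (# 0) (# 1))
        (occurrence-vertex p1432 occ (# 0) (# 2))
        (occurrence-vertex p1432 occ (# 0) (# 3))
        (inj₁ (refl , <⇒≢ (f-increasing (# 1) (# 2) <-by-computation)))
        (inj₁ (refl , <⇒≢ (f-increasing (# 1) (# 3) <-by-computation)))
        (inj₁ (refl , <⇒≢ (f-increasing (# 2) (# 3) <-by-computation)))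

    avoids-3214 : Avoids π p3214
    avoids-3214 occ@(f , f-increasing , _) =
      no-triangle
        (occurrence-vertex p3214 occ (# 0) (# 3))
        (occurrence-vertex p3214 occ (# 1) (# 3))
        (occurrence-vertex p3214 occ (# 2) (# 3))
        (inj₂ (inj₂ (inj₂ (refl , <⇒≢ (f-increasing (# 0) (# 1) <-by-computation)))))
        (inj₂ (inj₂ (inj₂ (refl , <⇒≢ (f-increasing (# 0) (# 2) <-by-computation)))))
        (inj₂ (inj₂ (inj₂ (refl , <⇒≢ (f-increasing (# 1) (# 2) <-by-computation)))))

  LeftToRightMinimum RightToLeftMaximum : Pred (Fin n) 0ℓ
  LeftToRightMinimum x = ∀ m → m < x → π[ x ] < π[ m ]
  RightToLeftMaximum x = ∀ m → x < m → π[ m ] < π[ x ]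

  leftToRightMinimum? : Decidable LeftToRightMinimum
  leftToRightMinimum? x = all? λ m → (m <? x) →-dec (π[ x ] <? π[ m ])

  rightToLeftMaximum? : Decidable RightToLeftMaximum
  rightToLeftMaximum? x = all? λ m → (x <? m) →-dec (π[ m ] <? π[ x ])

  colour : V12 π → Bool
  colour ((i , j) , _) =
    parityBefore leftToRightMinimum? i xor parityBefore rightToLeftMaximum? j

  module _ (avoids-123 : Avoids π p123) where

    ascent-start-leftToRightMinimum : ∀ {a b} → Ascent a b → LeftToRightMinimum a
    ascent-start-leftToRightMinimum {a} ab m m<a with <-cmp π[ m ] π[ a ]
    ... | tri< πm<πa _ _ = ⊥-elim (avoids-123 (contains-123 (m<a , πm<πa) ab))
    ... | tri≈ _ πm≡πa _ = ⊥-elim (<-irrefl (π-injective πm≡πa) m<a)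
    ... | tri> _ _ πa<πm = πa<πm

    ascent-end-rightToLeftMaximum : ∀ {a b} → Ascent a b → RightToLeftMaximum b
    ascent-end-rightToLeftMaximum {b = b} ab m b<m with <-cmp π[ b ] π[ m ]
    ... | tri< πb<πm _ _ = ⊥-elim (avoids-123 (contains-123 ab (b<m , πb<πm)))
    ... | tri≈ _ πb≡πm _ = ⊥-elim (<-irrefl (π-injective πb≡πm) b<m)
    ... | tri> _ _ πm<πb = πm<πb

    rightToLeftMaximum-parity-flip : Avoids π p1432 → ∀ {i j l} → Ascent i j → Ascent i l → j < l →
      parityBefore rightToLeftMaximum? l ≡ not (parityBefore rightToLeftMaximum? j)
    rightToLeftMaximum-parity-flip avoids-1432 {i} {j} {l} ij il j<l =
      parityBefore-flip rightToLeftMaximum? j<l (ascent-end-rightToLeftMaximum ij) between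
      where
      between : ∀ {c} → j < c → c < l → ¬ RightToLeftMaximum c
      between j<c c<l c-max = avoids-1432
        (contains-1432 (proj₁ ij) j<c c<l (proj₂ il) (c-max l c<l) (ascent-end-rightToLeftMaximum ij _ j<c))

    leftToRightMinimum-parity-flip : Avoids π p3214 → ∀ {i k j} → Ascent i j → Ascent k j → i < k →
      parityBefore leftToRightMinimum? k ≡ not (parityBefore leftToRightMinimum? i)
    leftToRightMinimum-parity-flip avoids-3214 {i} {k} {j} ij kj i<k =
      parityBefore-flip leftToRightMinimum? i<k (ascent-start-leftToRightMinimum ij) between
      where
      between : ∀ {c} → i < c → c < k → ¬ LeftToRightMinimum c
      between i<c c<k c-min = avoids-3214
        (contains-3214 i<c c<k (proj₁ kj) (ascent-start-leftToRightMinimum kj _ c<k) (c-min i i<c) (proj₂ ij))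

  avoids⇒bipartite : InAv123-1432-3214 π → Bipartite (G12 π)
  avoids⇒bipartite (avoids-123 , avoids-1432 , avoids-3214) = colour , proper
    where
    open ≡-Reasoning

    L R : Fin n → Bool
    L = parityBefore leftToRightMinimum?
    R = parityBefore rightToLeftMaximum?

    flipped⇒≢ : ∀ {x y : Bool} → y ≡ not x → x ≢ y
    flipped⇒≢ y≡¬x x≡y = not-¬ refl (trans x≡y y≡¬x)

    shared-start : ∀ {i j l} (ij : Ascent i j) (il : Ascent i l) → j < l →
      colour ((i , l) , il) ≡ not (colour ((i , j) , ij))
    shared-start {i} {j} {l} ij il j<l = begin
      L i xor R l        ≡⟨ cong (L i xor_) (rightToLeftMaximum-parity-flip avoids-123 avoids-1432 ij il j<l) ⟩
      L i xor not (R j)  ≡⟨ sym (not-distribʳ-xor (L i) (R j)) ⟩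
      not (L i xor R j)  ∎

    shared-end : ∀ {i k j} (ij : Ascent i j) (kj : Ascent k j) → i < k →
      colour ((k , j) , kj) ≡ not (colour ((i , j) , ij))
    shared-end {i} {k} {j} ij kj i<k = begin
      L k xor R j        ≡⟨ cong (_xor R j) (leftToRightMinimum-parity-flip avoids-123 avoids-3214 ij kj i<k) ⟩
      not (L i) xor R j  ≡⟨ sym (not-distribˡ-xor (L i) (R j)) ⟩
      not (L i xor R j)  ∎

    proper : ∀ u v → Adj (G12 π) u v → colour u ≢ colour v
    proper ((i , j) , ij) ((.i , l) , il) (inj₁ (refl , j≢l)) with <-cmp j l
    ... | tri< j<l _ _ = flipped⇒≢ (shared-start ij il j<l)
    ... | tri≈ _ j≡l _ = ⊥-elim (j≢l j≡l)
    ... | tri> _ _ l<j = ≢-sym (flipped⇒≢ (shared-start il ij l<j))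
    proper ((i , j) , ij) ((k , .i) , ki) (inj₂ (inj₁ (refl , _))) =
      ⊥-elim (avoids-123 (contains-123 ki ij))
    proper ((i , j) , ij) ((.j , l) , jl) (inj₂ (inj₂ (inj₁ (refl , _)))) =
      ⊥-elim (avoids-123 (contains-123 ij jl))
    proper ((i , j) , ij) ((k , .j) , kj) (inj₂ (inj₂ (inj₂ (refl , i≢k)))) with <-cmp i k
    ... | tri< i<k _ _ = flipped⇒≢ (shared-end ij kj i<k)
    ... | tri≈ _ i≡k _ = ⊥-elim (i≢k i≡k)
    ... | tri> _ _ k<i = ≢-sym (flipped⇒≢ (shared-end kj ij k<i))

theorem5p4 : ∀ (n : ℕ) (π : Permutation′ n) → Bipartite (G12 π) ⇔ InAv123-1432-3214 π
theorem5p4 n π = mk⇔ (bipartite⇒avoids π) (avoids⇒bipartite π)
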